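{- For every connected graph $G$, $b(G)\le b_T(G)\le b(G)+1$.
   Context: For a finite simple graph $H$, a burning sequence is a sequence $(b_1,\dots,b_t)$ of vertices such that every vertex $v$ satisfies $d_H(v,b_i)\le t-i$ for some $i\in\{1,\dots,t\}$; $b(H)$ is the minimum length of a burning sequence. The total graph $T(G)$ has vertex set $V(G)\cup E(G)$, where two elements are adjacent iff they are adjacent vertices of $G$, or edges of $G$ sharing an endpoint, or a vertex and an edge incident to it. The total burning number of $G$ is $b_T(G)=b(T(G))$. -}

module Defs where

open import Data.Nat using (ℕ; zero; suc; _≤_; _∸_)
open import Data.Fin using (Fin; toℕ) renaming (_<_ to _<ᶠ_)
open import Data.Bool using (Bool; true)
open import Data.Sum using (_⊎_)
open import Data.Product using (Σ; Σ-syntax; _×_)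
open import Relation.Binary.PropositionalEquality using (_≡_)
open import Relation.Nullary using (¬_)

record Graph : Set₁ where
  field
    V   : Set
    Adj : V → V → Set

record FinSimpleGraph (n : ℕ) : Set where
  field
    adj   : Fin n → Fin n → Bool
    sym   : ∀ i j → adj i j ≡ adj j i
    irrefl : ∀ i → ¬ (adj i i ≡ true)

open FinSimpleGraph public

toGraph : ∀ {n} → FinSimpleGraph n → Graph
toGraph {n} G = record { V = Fin n ; Adj = λ i j → adj G i j ≡ true }

data Walk (H : Graph) : Graph.V H → Graph.V H → ℕ → Set where
  here : ∀ {u} → Walk H u u zero
  step : ∀ {u w v k} → Graph.Adj H u w → Walk H w v k → Walk H u v (suc k)

Dist≤ : (H : Graph) → Graph.V H → Graph.V H → ℕ → Set
Dist≤ H u v k = Σ[ m ∈ ℕ ] (m ≤ k × Walk H u v m)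

Connected : Graph → Set
Connected H = ∀ u v → Σ[ k ∈ ℕ ] Walk H u v k

-- A burning sequence of length t: b : Fin t → V, where b i is b_{i+1};
-- every vertex v satisfies d(v, b_{i+1}) ≤ t - (i+1) for some i.
IsBurningSeq : (H : Graph) (t : ℕ) → (Fin t → Graph.V H) → Set
IsBurningSeq H t b = ∀ v → Σ[ i ∈ Fin t ] Dist≤ H v (b i) (t ∸ suc (toℕ i))

IsBurningNumber : Graph → ℕ → Set
IsBurningNumber H k =
  Σ[ b ∈ (Fin k → Graph.V H) ] IsBurningSeq H k b
  × (∀ t (b : Fin t → Graph.V H) → IsBurningSeq H t b → k ≤ t)

-- Edges of G: pairs i < j with i ~ j (each edge counted once).
Edge : ∀ {n} → FinSimpleGraph n → Set
Edge {n} G = Σ[ i ∈ Fin n ] Σ[ j ∈ Fin n ] (i <ᶠ j × adj G i j ≡ true)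

end₁ : ∀ {n} (G : FinSimpleGraph n) → Edge G → Fin n
end₁ _ (i Data.Product., _) = i

end₂ : ∀ {n} (G : FinSimpleGraph n) → Edge G → Fin n
end₂ _ (_ Data.Product., j Data.Product., _) = j

Incident : ∀ {n} (G : FinSimpleGraph n) → Fin n → Edge G → Set
Incident G v e = v ≡ end₁ G e ⊎ v ≡ end₂ G e

TAdj : ∀ {n} (G : FinSimpleGraph n) → (Fin n ⊎ Edge G) → (Fin n ⊎ Edge G) → Set
TAdj G (Data.Sum.inj₁ u) (Data.Sum.inj₁ v) = adj G u v ≡ true
TAdj G (Data.Sum.inj₁ u) (Data.Sum.inj₂ e) = Incident G u e
TAdj G (Data.Sum.inj₂ e) (Data.Sum.inj₁ u) = Incident G u e
TAdj G (Data.Sum.inj₂ e) (Data.Sum.inj₂ f) =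
  ¬ (end₁ G e ≡ end₁ G f × end₂ G e ≡ end₂ G f)
  × (end₁ G e ≡ end₁ G f ⊎ end₁ G e ≡ end₂ G f ⊎ end₂ G e ≡ end₁ G f ⊎ end₂ G e ≡ end₂ G f)

Total : ∀ {n} → FinSimpleGraph n → Graph
Total {n} G = record { V = Fin n ⊎ Edge G ; Adj = TAdj G }

-- Lower bound: sending every element of T(G) to a vertex of G (an edge to one of
-- its ends) does not increase distances measured from vertices, so a burning
-- sequence of T(G) projects to one of G of the same length.  Upper bound: every
-- element of T(G) is within distance 1 of a vertex, so a burning sequence of G,
-- followed by one arbitrary extra source, burns T(G).
module Submission where

open import Defs hiding (sym)
open import Data.Nat using (ℕ; zero; suc; _≤_; _<_; _+_; _∸_; z≤n; s≤s)
open import Data.Nat.Properties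
  using (≤-trans; ≤-reflexive; n≤1+n; n<1+n; ≮⇒≥; m<1+n⇒m<n∨m≡n; +-mono-≤; +-∸-assoc)
open import Data.Fin using (Fin; zero; suc; toℕ; inject₁; _≟_) renaming (_<_ to _<ᶠ_)
open import Data.Fin.Properties using (any?; toℕ-inject₁; toℕ<n) renaming (<-irrelevant to <ᶠ-irrelevant; _<?_ to _<ᶠ?_)
open import Data.Bool using (true)
import Data.Bool.Properties as Bool
open import Data.Vec.Functional using (Vector; []; _∷_; head; tail)
open import Data.Sum using (_⊎_; inj₁; inj₂; [_,_])
import Data.Sum.Properties as Sum
import Data.Product.Properties as Product
open import Data.Product using (Σ; Σ-syntax; ∃; _×_; _,_)
open import Data.Empty using (⊥-elim)
open import Function using (_∘_)
open import Relation.Nullary using (Dec; yes; no; ¬_; Irrelevant)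
open import Relation.Nullary.Decidable using (map′; _×-dec_; _⊎-dec_; ¬?; decidable-stable)
open import Relation.Unary using (Decidable)
open import Relation.Binary.Definitions using (DecidableEquality)
open import Relation.Binary.PropositionalEquality using (_≡_; refl; sym; trans; cong; cong₂; subst; _≗_)
open import Axiom.UniquenessOfIdentityProofs using (module Decidable⇒UIP)

Searchable : Set → Set₁
Searchable A = ∀ {P : A → Set} → Decidable P → Dec (∃ P)

search-Fin : ∀ n → Searchable (Fin n)
search-Fin n = any?

search-⊎ : ∀ {A B} → Searchable A → Searchable B → Searchable (A ⊎ B)
search-⊎ sA sB P? =
  map′ [ (λ (a , p) → inj₁ a , p) , (λ (b , p) → inj₂ b , p) ]
       (λ { (inj₁ a , p) → inj₁ (a , p) ; (inj₂ b , p) → inj₂ (b , p) })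
       (sA (P? ∘ inj₁) ⊎-dec sB (P? ∘ inj₂))

search-Σ : ∀ {A} {B : A → Set} → Searchable A → (∀ a → Searchable (B a)) → Searchable (Σ A B)
search-Σ sA sB P? =
  map′ (λ (a , b , p) → (a , b) , p) (λ ((a , b) , p) → a , b , p)
       (sA (λ a → sB a (λ b → P? (a , b))))

search-irrelevant : ∀ {A} → Dec A → Irrelevant A → Searchable A
search-irrelevant (no ¬a) irr P? = no λ (a , _) → ¬a a
search-irrelevant (yes a) irr {P} P? =
  map′ (a ,_) (λ (a′ , p) → subst P (irr a′ a) p) (P? a)

∀? : ∀ {A} → Searchable A → ∀ {P : A → Set} → Decidable P → Dec (∀ a → P a)
∀? sA P? with sA (¬? ∘ P?)
... | yes (a , ¬pa) = no λ all → ¬pa (all a)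
... | no ¬∃¬ = yes λ a → decidable-stable (P? a) (λ ¬pa → ¬∃¬ (a , ¬pa))

-- Without function extensionality we can only search for vectors satisfying a
-- predicate that is invariant under pointwise equality.
search-Vector : ∀ {A} → Searchable A → ∀ t {P : Vector A t → Set}
  → (∀ {f g} → f ≗ g → P f → P g) → Decidable P → Dec (∃ P)
search-Vector sA zero P-resp P? =
  map′ ([] ,_) (λ (f , p) → P-resp (λ ()) p) (P? [])
search-Vector sA (suc t) P-resp P? =
  map′ (λ (a , f , p) → a ∷ f , p)
       (λ (f , p) → head f , tail f , P-resp (λ { zero → refl ; (suc i) → refl }) p)
       (sA λ a → search-Vector sA t (P-resp ∘ ∷-cong a) (P? ∘ (a ∷_)))
  where
  ∷-cong : ∀ a {f g : Vector _ t} → f ≗ g → (a ∷ f) ≗ (a ∷ g)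
  ∷-cong a f≗g zero = refl
  ∷-cong a f≗g (suc i) = f≗g i

Least : (ℕ → Set) → Set
Least P = Σ[ k ∈ ℕ ] P k × (∀ t → P t → k ≤ t)

least-below : ∀ {P : ℕ → Set} → Decidable P → ∀ n → (∀ t → t < n → ¬ P t) ⊎ Least P
least-below P? zero = inj₁ λ _ ()
least-below P? (suc n) with least-below P? n | P? n
... | inj₂ least | _ = inj₂ least
... | inj₁ none | yes pn = inj₂ (n , pn , λ t pt → ≮⇒≥ λ t<n → none t t<n pt)
... | inj₁ none | no ¬pn =
  inj₁ λ t t<1+n → [ none t , (λ { refl → ¬pn }) ] (m<1+n⇒m<n∨m≡n t<1+n)

least-exists : ∀ {P : ℕ → Set} → Decidable P → ∀ {t} → P t → Least P
least-exists P? {t} pt with least-below P? (suc t)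
... | inj₁ none = ⊥-elim (none t (n<1+n t) pt)
... | inj₂ least = least

module _ {H : Graph} where
  open Graph H

  walk-++ : ∀ {u w v m k} → Walk H u w m → Walk H w v k → Walk H u v (m + k)
  walk-++ here q = q
  walk-++ (step a p) q = step a (walk-++ p q)

  Dist≤-refl : ∀ {u r} → Dist≤ H u u r
  Dist≤-refl = 0 , z≤n , here

  Dist≤-weaken : ∀ {u v r s} → r ≤ s → Dist≤ H u v r → Dist≤ H u v s
  Dist≤-weaken r≤s (m , m≤r , p) = m , ≤-trans m≤r r≤s , p

  Dist≤-step : ∀ {u w v r} → Adj u w → Dist≤ H w v r → Dist≤ H u v (suc r)
  Dist≤-step a (m , m≤r , p) = suc m , s≤s m≤r , step a p

  Dist≤-trans : ∀ {u w v r s} → Dist≤ H u w r → Dist≤ H w v s → Dist≤ H u v (r + s)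
  Dist≤-trans (m , m≤r , p) (k , k≤s , q) = m + k , +-mono-≤ m≤r k≤s , walk-++ p q

  Dist≤-resp-target : ∀ {u v v′ r} → v ≡ v′ → Dist≤ H u v r → Dist≤ H u v′ r
  Dist≤-resp-target {u} {r = r} = subst (λ v → Dist≤ H u v r)

  IsBurningSeq-resp-≗ : ∀ {t} {b c : Vector V t} → b ≗ c → IsBurningSeq H t b → IsBurningSeq H t c
  IsBurningSeq-resp-≗ b≗c burns v = let i , d = burns v in i , Dist≤-resp-target (b≗c i) d

module DecidableBurning (H : Graph) (search : Searchable (Graph.V H))
  (_≟ⱽ_ : DecidableEquality (Graph.V H)) (adj? : ∀ u v → Dec (Graph.Adj H u v)) where
  open Graph H

  dist≤? : ∀ r u v → Dec (Dist≤ H u v r)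
  dist≤? zero u v = map′ (λ { refl → Dist≤-refl }) (λ { (_ , z≤n , here) → refl }) (u ≟ⱽ v)
  dist≤? (suc r) u v = map′ to from (u ≟ⱽ v ⊎-dec search (λ w → adj? u w ×-dec dist≤? r w v))
    where
    to : u ≡ v ⊎ (∃ λ w → Adj u w × Dist≤ H w v r) → Dist≤ H u v (suc r)
    to (inj₁ refl) = Dist≤-refl
    to (inj₂ (w , a , d)) = Dist≤-step a d
    from : Dist≤ H u v (suc r) → u ≡ v ⊎ (∃ λ w → Adj u w × Dist≤ H w v r)
    from (_ , _ , here) = inj₁ refl
    from (_ , s≤s m≤r , step {w = w} a p) = inj₂ (w , a , _ , m≤r , p)

  isBurningSeq? : ∀ t → Decidable (IsBurningSeq H t)
  isBurningSeq? t b = ∀? search (λ v → any? (λ i → dist≤? _ v (b i)))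

  burningNumber-exists : ∀ {t} {b : Vector V t} → IsBurningSeq H t b → ∃ (IsBurningNumber H)
  burningNumber-exists {b = b} burns =
    let k , (c , c-burns) , minimal = least-exists burnable? (b , burns)
    in k , c , c-burns , λ t b′ b′-burns → minimal t (b′ , b′-burns)
    where
    burnable? : Decidable (λ t → ∃ (IsBurningSeq H t))
    burnable? t = search-Vector search t IsBurningSeq-resp-≗ (isBurningSeq? t)

snoc : ∀ {A : Set} {k} → Vector A k → A → Vector A (suc k)
snoc {k = zero} b x _ = x
snoc {k = suc k} b x zero = head b
snoc {k = suc k} b x (suc i) = snoc (tail b) x i

snoc-inject₁ : ∀ {A : Set} {k} (b : Vector A k) x i → snoc b x (inject₁ i) ≡ b i
snoc-inject₁ {k = suc k} b x zero = refl
snoc-inject₁ {k = suc k} b x (suc i) = snoc-inject₁ (tail b) x i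

radius-inject₁ : ∀ {k} (i : Fin k) → suc k ∸ suc (toℕ (inject₁ i)) ≡ suc (k ∸ suc (toℕ i))
radius-inject₁ {k} i = trans (cong (λ j → suc k ∸ suc j) (toℕ-inject₁ i)) (+-∸-assoc 1 (toℕ<n i))

module _ {H H′ : Graph} (φ : Graph.V H → Graph.V H′) where
  open Graph

  burningSeq-pullback : (ρ : V H′ → V H) → (∀ {v y r} → Dist≤ H′ (φ v) y r → Dist≤ H v (ρ y) r)
    → ∀ {t c} → IsBurningSeq H′ t c → IsBurningSeq H t (ρ ∘ c)
  burningSeq-pullback ρ shadow burns v = let i , d = burns (φ v) in i , shadow d

  burningSeq-snoc : (∀ {u v r} → Dist≤ H u v r → Dist≤ H′ (φ u) (φ v) r)
    → (ρ : V H′ → V H) → (∀ x → Dist≤ H′ x (φ (ρ x)) 1)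
    → ∀ {k b} → IsBurningSeq H k b → ∀ x₀ → IsBurningSeq H′ (suc k) (snoc (φ ∘ b) x₀)
  burningSeq-snoc φ-dist ρ near {b = b} burns x₀ x =
    let i , d = burns (ρ x)
    in inject₁ i
     , Dist≤-resp-target (sym (snoc-inject₁ (φ ∘ b) x₀ i))
         (Dist≤-weaken (≤-reflexive (sym (radius-inject₁ i)))
           (Dist≤-trans (near x) (φ-dist d)))

module TotalGraph {n} (G : FinSimpleGraph n) where

  edge-irrelevant : ∀ {i j} → Irrelevant (i <ᶠ j × adj G i j ≡ true)
  edge-irrelevant (p , q) (p′ , q′) =
    cong₂ _,_ (<ᶠ-irrelevant p p′) (Decidable⇒UIP.≡-irrelevant Bool._≟_ q q′)

  search-Edge : Searchable (Edge G)
  search-Edge = search-Σ (search-Fin n) λ i → search-Σ (search-Fin n) λ j →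
    search-irrelevant ((i <ᶠ? j) ×-dec (adj G i j Bool.≟ true)) edge-irrelevant

  _≟ᴱ_ : DecidableEquality (Edge G)
  _≟ᴱ_ = Product.≡-dec _≟_ (Product.≡-dec _≟_ λ p q → yes (edge-irrelevant p q))

  adjᵀ? : ∀ x y → Dec (Graph.Adj (Total G) x y)
  adjᵀ? (inj₁ u) (inj₁ v) = adj G u v Bool.≟ true
  adjᵀ? (inj₁ u) (inj₂ e) = (u ≟ end₁ G e) ⊎-dec (u ≟ end₂ G e)
  adjᵀ? (inj₂ e) (inj₁ u) = (u ≟ end₁ G e) ⊎-dec (u ≟ end₂ G e)
  adjᵀ? (inj₂ e) (inj₂ f) =
    ¬? ((end₁ G e ≟ end₁ G f) ×-dec (end₂ G e ≟ end₂ G f))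
    ×-dec ((end₁ G e ≟ end₁ G f) ⊎-dec (end₁ G e ≟ end₂ G f)
           ⊎-dec (end₂ G e ≟ end₁ G f) ⊎-dec (end₂ G e ≟ end₂ G f))

  module BurningG = DecidableBurning (toGraph G) (search-Fin n) _≟_ (λ u v → adj G u v Bool.≟ true)
  module BurningT = DecidableBurning (Total G) (search-⊎ (search-Fin n) search-Edge)
    (Sum.≡-dec _≟_ _≟ᴱ_) adjᵀ?

  lift-walk : ∀ {u v m} → Walk (toGraph G) u v m → Walk (Total G) (inj₁ u) (inj₁ v) m
  lift-walk here = here
  lift-walk (step a p) = step a (lift-walk p)

  lift-dist : ∀ {u v r} → Dist≤ (toGraph G) u v r → Dist≤ (Total G) (inj₁ u) (inj₁ v) r
  lift-dist (m , m≤r , p) = m , m≤r , lift-walk p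

  foot : Fin n ⊎ Edge G → Fin n
  foot (inj₁ v) = v
  foot (inj₂ e) = end₁ G e

  dist-foot : ∀ x → Dist≤ (Total G) x (inj₁ (foot x)) 1
  dist-foot (inj₁ v) = Dist≤-refl
  dist-foot (inj₂ e) = Dist≤-step (inj₁ refl) Dist≤-refl

  EndOf : Fin n ⊎ Edge G → Fin n → Set
  EndOf (inj₁ v) a = a ≡ v
  EndOf (inj₂ e) a = Incident G a e

  foot-endOf : ∀ x → EndOf x (foot x)
  foot-endOf (inj₁ v) = refl
  foot-endOf (inj₂ e) = inj₁ refl

  ends-dist : ∀ e {a b} → Incident G a e → Incident G b e → Dist≤ (toGraph G) a b 1
  ends-dist e (inj₁ refl) (inj₁ refl) = Dist≤-refl
  ends-dist (i , j , _ , i~j) (inj₁ refl) (inj₂ refl) = Dist≤-step i~j Dist≤-refl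
  ends-dist (i , j , _ , i~j) (inj₂ refl) (inj₁ refl) =
    Dist≤-step (trans (FinSimpleGraph.sym G j i) i~j) Dist≤-refl
  ends-dist e (inj₂ refl) (inj₂ refl) = Dist≤-refl

  shared-end : ∀ e f → Graph.Adj (Total G) (inj₂ e) (inj₂ f) → ∃ λ s → Incident G s e × Incident G s f
  shared-end e _ (_ , inj₁ q) = end₁ G e , inj₁ refl , inj₁ q
  shared-end e _ (_ , inj₂ (inj₁ q)) = end₁ G e , inj₁ refl , inj₂ q
  shared-end e _ (_ , inj₂ (inj₂ (inj₁ q))) = end₂ G e , inj₂ refl , inj₁ q
  shared-end e _ (_ , inj₂ (inj₂ (inj₂ q))) = end₂ G e , inj₂ refl , inj₂ q

  excess : Fin n ⊎ Edge G → ℕ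
  excess (inj₁ _) = 0
  excess (inj₂ _) = 1

  -- Walking through an edge costs nothing in G, since the walk may continue from
  -- the end it entered by; only a walk starting at an edge pays one extra step.
  project-walk : ∀ {x y m a c} → Walk (Total G) x y m → EndOf x a → EndOf y c
    → Dist≤ (toGraph G) a c (excess x + m)
  project-walk {inj₁ v} here refl refl = Dist≤-refl
  project-walk {inj₂ e} here a∈e c∈e = ends-dist e a∈e c∈e
  project-walk {inj₁ v} (step {w = inj₁ w} v~w p) refl c∈y =
    Dist≤-step v~w (project-walk p refl c∈y)
  project-walk {inj₁ v} (step {w = inj₂ f} v∈f p) refl c∈y = project-walk p v∈f c∈y
  project-walk {inj₂ e} (step {w = inj₁ w} w∈e p) a∈e c∈y =
    Dist≤-weaken (n≤1+n _) (Dist≤-trans (ends-dist e a∈e w∈e) (project-walk p refl c∈y))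
  project-walk {inj₂ e} (step {w = inj₂ f} e~f p) a∈e c∈y =
    let s , s∈e , s∈f = shared-end e f e~f
    in Dist≤-trans (ends-dist e a∈e s∈e) (project-walk p s∈f c∈y)

  project-dist : ∀ {v y r} → Dist≤ (Total G) (inj₁ v) y r → Dist≤ (toGraph G) v (foot y) r
  project-dist {y = y} (m , m≤r , p) = Dist≤-weaken m≤r (project-walk p refl (foot-endOf y))

theorem7 : ∀ (n : ℕ) (G : FinSimpleGraph n) → 0 < n → Connected (toGraph G)
             → Σ[ k ∈ ℕ ] Σ[ l ∈ ℕ ] (IsBurningNumber (toGraph G) k × IsBurningNumber (Total G) l × k ≤ l × l ≤ suc k)
theorem7 zero G () _
theorem7 (suc n) G _ _ =
  let k , b , b-burns , b-minimal = BurningG.burningNumber-exists all-vertices-burn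
      extended-burns = burningSeq-snoc inj₁ lift-dist foot dist-foot b-burns (inj₁ zero)
      l , c , c-burns , c-minimal = BurningT.burningNumber-exists extended-burns
  in k , l , (b , b-burns , b-minimal) , (c , c-burns , c-minimal)
   , b-minimal l _ (burningSeq-pullback inj₁ foot project-dist c-burns)
   , c-minimal (suc k) _ extended-burns
  where
  open TotalGraph G
  all-vertices-burn : IsBurningSeq (toGraph G) (suc n) (λ v → v)
  all-vertices-burn v = v , Dist≤-refl
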